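{- Let $M_i=\{j\cdot 2^{ -i} : j\in\{0,\dots,2^i\}\}$; let $\mathbb{M}=\prod_{i\in\mathbb{N}}\mathsf{M}_i$ with $\mathsf{M}_i$ the discrete space on $M_i$. Let $\mathsf{M}$ be the set of $x\in\prod_i M_i$ with $\|x\|:=\sum_i x(i)<\infty$, topologised by the metric $(x,y)\mapsto\|x-y\|$. Define $g\colon\mathsf{M}\to\mathsf{2}^{\mathbb{N}\times\mathbb{F}}$ by $g(y)(k,a,b)=\mathtt{0}$ if $\sum_{i=a}^{a+b}y(i)\le 2^{ -k}$, $g(y)(k,a,b)=\mathtt{1}$ otherwise, and $g(y)(k,\infty,\infty)=\mathtt{0}$ ($k,a,b\in\mathbb{N}$). Then the map $e_{\mathsf{M}}\colon\mathsf{M}\to\mathbb{M}\times\mathsf{2}^{\mathbb{N}\times\mathbb{F}}$, $e_{\mathsf{M}}(x)=(x,g(x))$, is injective and continuous (the codomain being the QCB-product).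
   Context: $\mathsf{2}$ is the discrete space $\{\mathtt{0},\mathtt{1}\}$. The countable fan $\mathbb{F}$ has underlying set $\mathbb{N}^2\cup\{(\infty,\infty)\}$ with metric $d((a,b),(\infty,\infty))=2^{ -a}$, $d((a,b),(a',b'))=\max\{2^{ -a},2^{ -a'}\}$ for distinct $(a,b),(a',b')\in\mathbb{N}^2$. QCB is the cartesian closed category of topological quotients of countably based spaces; the exponential $Y^X$ is the set of continuous maps $X\to Y$ with the sequentialisation of the compact-open topology (convergence = continuous convergence), and products carry the sequentialisation of the product topology. -}

module Defs where

open import Data.Nat as ℕ using (ℕ; zero; suc; _^_)
open import Data.Fin using (Fin; toℕ)
open import Data.Integer using (+_)
open import Data.Rational using (ℚ; 0ℚ; 1ℚ; ½; _+_; _*_; _-_; _≤_; _<_; _⊔_; ∣_∣; _/_)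
open import Data.Product using (Σ; _×_; _,_; ∃)
open import Data.Bool using (Bool; true; false; if_then_else_)
open import Relation.Binary.PropositionalEquality using (_≡_)

pow½ : ℕ → ℚ
pow½ zero = 1ℚ
pow½ (suc i) = ½ * pow½ i

-- ∏_i M_i : the i-th coordinate is j ∈ {0,…,2^i}, standing for j·2^{-i}
ΠM : Set
ΠM = (i : ℕ) → Fin (suc (2 ^ i))

val : ΠM → ℕ → ℚ
val x i = ((+ toℕ (x i)) / 1) * pow½ i

sumFrom : (ℕ → ℚ) → ℕ → ℕ → ℚ
sumFrom f a zero = f a
sumFrom f a (suc m) = f a + sumFrom f (suc a) m

partial : (ℕ → ℚ) → ℕ → ℚ
partial f zero = 0ℚ
partial f (suc n) = partial f n + f n

-- ‖x‖ < ∞ : the (nonnegative) series Σ x(i) converges, stated in Cauchy form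
Summable : ΠM → Set
Summable x = ∀ (ε : ℚ) → 0ℚ < ε → ∃ λ N → ∀ m → sumFrom (val x) N m ≤ ε

record 𝖬 : Set where
  constructor mk
  field
    pt   : ΠM
    summ : Summable pt
open 𝖬 public

-- ‖x - y‖ ≤ ε   (the norm is the supremum of the partial sums of |x(i)-y(i)|)
dist≤ : ΠM → ΠM → ℚ → Set
dist≤ x y ε = ∀ n → partial (λ i → ∣ val x i - val y i ∣) n ≤ ε

_→𝖬_ : (ℕ → 𝖬) → 𝖬 → Set
s →𝖬 x = ∀ (ε : ℚ) → 0ℚ < ε → ∃ λ N → ∀ n → N ℕ.≤ n → dist≤ (pt (s n)) (pt x) ε

_→disc_ : {A : Set} → (ℕ → A) → A → Set
s →disc a = ∃ λ N → ∀ n → N ℕ.≤ n → s n ≡ a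

_→𝕄_ : (ℕ → ΠM) → ΠM → Set
s →𝕄 x = ∀ i → (λ n → s n i) →disc x i

data 𝔽 : Set where
  pr  : ℕ → ℕ → 𝔽
  inf : 𝔽

_≡ᵇ_ : ℕ → ℕ → Bool
_≡ᵇ_ = ℕ._≡ᵇ_

dF : 𝔽 → 𝔽 → ℚ
dF inf inf = 0ℚ
dF (pr a b) inf = pow½ a
dF inf (pr a b) = pow½ a
dF (pr a b) (pr a' b') =
  if (a ≡ᵇ a') Data.Bool.∧ (b ≡ᵇ b') then 0ℚ else (pow½ a ⊔ pow½ a')
  where import Data.Bool

_→𝔽_ : (ℕ → 𝔽) → 𝔽 → Set
s →𝔽 p = ∀ (ε : ℚ) → 0ℚ < ε → ∃ λ N → ∀ n → N ℕ.≤ n → dF (s n) p ≤ ε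

_→ℕ𝔽_ : (ℕ → ℕ × 𝔽) → ℕ × 𝔽 → Set
s →ℕ𝔽 (k , p) = ((λ n → Data.Product.proj₁ (s n)) →disc k)
              × ((λ n → Data.Product.proj₂ (s n)) →𝔽 p)
  where import Data.Product

-- 𝟚 = Bool (false = 𝟶, true = 𝟷); a (sequentially) continuous map ℕ × 𝔽 → 𝟚
Cont : (ℕ × 𝔽 → Bool) → Set
Cont f = ∀ (s : ℕ → ℕ × 𝔽) z → s →ℕ𝔽 z → (λ n → f (s n)) →disc f z

-- convergence in the exponential 𝟚^{ℕ×𝔽}: continuous convergence
_→Exp_ : (ℕ → (ℕ × 𝔽 → Bool)) → (ℕ × 𝔽 → Bool) → Set
fs →Exp f = ∀ (s : ℕ → ℕ × 𝔽) z → s →ℕ𝔽 z → (λ n → fs n (s n)) →disc f z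

g : 𝖬 → ℕ × 𝔽 → Bool
g y (k , inf) = false
g y (k , pr a b) = if sumFrom (val (pt y)) a b Data.Rational.≤ᵇ pow½ k then false else true
  where import Data.Rational

e : 𝖬 → ΠM × (ℕ × 𝔽 → Bool)
e x = pt x , g x

-- Injectivity is trivial since e x records x itself.  Convergence ‖sₙ − x‖ → 0 forces
-- each coordinate to converge, and since M_i is 2^{-i}-separated, to be eventually
-- constant; this gives convergence in 𝕄 and settles g at the isolated points (k, a, b),
-- where g only reads the finitely many coordinates a, …, a+b.  At (k, ∞) the value
-- 𝟶 is reached because a sequence approaching ∞ in 𝔽 eventually lives in columns
-- a ≥ N, and past N every finite block sum of sₙ is at most (tail of x) + ‖sₙ − x‖,
-- both of which are eventually ≤ 2^{-(k+1)}.
module Submission where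

open import Defs
open import Data.Nat using (ℕ)
open import Data.Product using (_×_; proj₁; proj₂; _,_; ∃)
open import Relation.Binary.PropositionalEquality using (_≡_)

open import Data.Nat as ℕ using (zero; suc; z≤n; s≤s; _≤′_; ≤′-reflexive; ≤′-step)
import Data.Nat.Properties as ℕ
open import Data.Integer as ℤ using (+_)
import Data.Integer.Properties as ℤ
open import Data.Rational
  using (ℚ; 0ℚ; 1ℚ; ½; _+_; _*_; _-_; -_; _/_; _≤_; _<_; ∣_∣; mkℚ; *≤*; _≤ᵇ_; NonNegative; nonNegative)
import Data.Rational.Properties as ℚ
import Data.Rational.Unnormalised as ℚᵘ
import Data.Rational.Unnormalised.Properties as ℚᵘ
open import Data.Rational.Solver using (module +-*-Solver)
open +-*-Solver
open import Data.Integer.Tactic.RingSolver using (solve-∀)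
open import Data.Nat.Coprimality using (1-coprimeTo)
import Data.Nat.Coprimality as Coprime
open import Data.Sum using (inj₁; inj₂)
open import Data.Empty using (⊥; ⊥-elim)
open import Data.Unit using (⊤)
open import Data.Bool using (true; false; if_then_else_)
open import Data.Bool.Properties using (T-≡)
open import Data.Fin using (toℕ)
import Data.Fin.Properties as Fin
open import Function.Bundles using (Equivalence)
open import Function using (_∘_)
open import Relation.Binary.Definitions using (tri<; tri≈; tri>)
open import Relation.Binary.PropositionalEquality
  using (refl; sym; trans; cong; cong₂; subst; subst₂; module ≡-Reasoning)
open import Relation.Nullary using (yes; no)

private variable
  a b k m n N : ℕ
  p q δ ε : ℚ
  P Q : ℕ → Set

<⇒≱ : p < q → q ≤ p → ⊥
<⇒≱ p<q q≤p = ℚ.<-irrefl refl (ℚ.<-≤-trans p<q q≤p)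

p≤q+p : ∀ {p q} → 0ℚ ≤ q → p ≤ q + p
p≤q+p {p} {q} 0≤q = subst (_≤ q + p) (ℚ.+-identityˡ p) (ℚ.+-monoˡ-≤ p 0≤q)

p≤∣p∣ : ∀ p → p ≤ ∣ p ∣
p≤∣p∣ p with ℚ.∣p∣≡p∨∣p∣≡-p p
... | inj₁ ∣p∣≡p  = ℚ.≤-reflexive (sym ∣p∣≡p)
... | inj₂ ∣p∣≡-p = ℚ.≤-trans p≤0 (ℚ.0≤∣p∣ p)
  where
  0≤-p : 0ℚ ≤ - p
  0≤-p = subst (0ℚ ≤_) ∣p∣≡-p (ℚ.0≤∣p∣ p)
  p≤0 : p ≤ 0ℚ
  p≤0 = subst (_≤ 0ℚ) (solve 1 (λ p → :- (:- p) := p) refl p) (ℚ.neg-antimono-≤ 0≤-p)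

∣p-q∣≡∣q-p∣ : ∀ p q → ∣ p - q ∣ ≡ ∣ q - p ∣
∣p-q∣≡∣q-p∣ p q = trans (sym (ℚ.∣-p∣≡∣p∣ (p - q)))
  (cong ∣_∣ (solve 2 (λ p q → :- (p :- q) := q :- p) refl p q))

p≤q+∣p-q∣ : ∀ p q → p ≤ q + ∣ p - q ∣
p≤q+∣p-q∣ p q = subst (_≤ q + ∣ p - q ∣) (solve 2 (λ p q → q :+ (p :- q) := p) refl p q)
  (ℚ.+-monoʳ-≤ q (p≤∣p∣ (p - q)))

-- val x i is definitionally ι (toℕ (x i)) * pow½ i.
ι : ℕ → ℚ
ι n = + n / 1

-- ι n is stuck for variable n (normalisation computes a gcd); rewriting with this unblocks it.
ι≡mkℚ : ∀ n → ι n ≡ mkℚ (+ n) 0 (Coprime.sym (1-coprimeTo n))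
ι≡mkℚ n = ℚ.normalize-coprime (Coprime.sym (1-coprimeTo n))

ι-mono-≤ : m ℕ.≤ n → ι m ≤ ι n
ι-mono-≤ {m} {n} m≤n rewrite ι≡mkℚ m | ι≡mkℚ n = *≤* (ℤ.*-monoʳ-≤-nonNeg (+ 1) (ℤ.+≤+ m≤n))

ι-suc : ∀ n → ι (suc n) ≡ 1ℚ + ι n
ι-suc n rewrite ι≡mkℚ (suc n) | ι≡mkℚ n = ℚ.toℚᵘ-injective
  (ℚᵘ.≃-trans (ℚᵘ.*≡* (cross-multiplied (+ n)))
              (ℚᵘ.≃-sym (ℚ.toℚᵘ-homo-+ 1ℚ (mkℚ (+ n) 0 (Coprime.sym (1-coprimeTo n))))))
  where
  cross-multiplied : ∀ i → (+ 1 ℤ.+ i) ℤ.* + 1 ≡ (+ 1 ℤ.* + 1 ℤ.+ i ℤ.* + 1) ℤ.* + 1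
  cross-multiplied = solve-∀

ι-nonNeg : ∀ n → 0ℚ ≤ ι n
ι-nonNeg n = ι-mono-≤ {0} {n} z≤n

1+ι-≤ : m ℕ.< n → 1ℚ + ι m ≤ ι n
1+ι-≤ {m} {n} m<n = subst (_≤ _) (ι-suc m) (ι-mono-≤ {suc m} {n} m<n)

0<pow½ : ∀ i → 0ℚ < pow½ i
0<pow½ zero    = ℚ.positive⁻¹ 1ℚ
0<pow½ (suc i) = subst (_< ½ * pow½ i) (ℚ.*-zeroʳ ½) (ℚ.*-monoʳ-<-pos ½ (0<pow½ i))

0≤pow½ : ∀ i → 0ℚ ≤ pow½ i
0≤pow½ i = ℚ.<⇒≤ (0<pow½ i)

pow½-suc+pow½-suc : ∀ i → pow½ (suc i) + pow½ (suc i) ≡ pow½ i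
pow½-suc+pow½-suc i = solve 1 (λ p → con ½ :* p :+ con ½ :* p := p) refl (pow½ i)

pow½-suc< : ∀ i → pow½ (suc i) < pow½ i
pow½-suc< i = subst₂ _<_ (ℚ.+-identityʳ _) (pow½-suc+pow½-suc i)
  (ℚ.+-monoʳ-< (pow½ (suc i)) (0<pow½ (suc i)))

pow½-antimono-≤ : m ℕ.≤ n → pow½ n ≤ pow½ m
pow½-antimono-≤ m≤n = antimono′ (ℕ.≤⇒≤′ m≤n)
  where
  antimono′ : m ≤′ n → pow½ n ≤ pow½ m
  antimono′ (≤′-reflexive refl)        = ℚ.≤-refl
  antimono′ {n = suc n} (≤′-step m≤′n) = ℚ.≤-trans (ℚ.<⇒≤ (pow½-suc< n)) (antimono′ m≤′n)

pow½-antimono-< : m ℕ.< n → pow½ n < pow½ m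
pow½-antimono-< {m} m<n = ℚ.≤-<-trans (pow½-antimono-≤ m<n) (pow½-suc< m)

pow½-cancel-≤ : pow½ m ≤ pow½ n → n ℕ.≤ m
pow½-cancel-≤ {m} {n} pow½m≤pow½n with n ℕ.≤? m
... | yes n≤m = n≤m
... | no  n≰m = ⊥-elim (<⇒≱ (pow½-antimono-< (ℕ.≰⇒> n≰m)) pow½m≤pow½n)

multiples-separated : 0ℚ ≤ p → m ℕ.< n → p ≤ ∣ ι m * p - ι n * p ∣
multiples-separated {p} {m} {n} 0≤p m<n = begin
  p                        ≡⟨ solve 2 (λ a p → ((con 1ℚ :+ a) :* p) :- a :* p := p) refl (ι m) p ⟨
  (1ℚ + ι m) * p - ι m * p ≤⟨ ℚ.+-monoˡ-≤ (- (ι m * p)) (ℚ.*-monoʳ-≤-nonNeg p (1+ι-≤ m<n)) ⟩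
  ι n * p - ι m * p        ≤⟨ p≤∣p∣ _ ⟩
  ∣ ι n * p - ι m * p ∣    ≡⟨ ∣p-q∣≡∣q-p∣ (ι n * p) (ι m * p) ⟩
  ∣ ι m * p - ι n * p ∣    ∎
  where
  open ℚ.≤-Reasoning
  instance
    p-nonNeg : NonNegative p
    p-nonNeg = nonNegative 0≤p

val-separated : ∀ (x y : ΠM) i → ∣ val x i - val y i ∣ < pow½ i → x i ≡ y i
val-separated x y i close with ℕ.<-cmp (toℕ (x i)) (toℕ (y i))
... | tri< x<y _ _ = ⊥-elim (<⇒≱ close (multiples-separated (0≤pow½ i) x<y))
... | tri≈ _ x≡y _ = Fin.toℕ-injective x≡y
... | tri> _ _ x>y = ⊥-elim (<⇒≱ close
  (subst (pow½ i ≤_) (∣p-q∣≡∣q-p∣ (val y i) (val x i)) (multiples-separated (0≤pow½ i) x>y)))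

val-nonNeg : ∀ x i → 0ℚ ≤ val x i
val-nonNeg x i = subst (_≤ val x i) (ℚ.*-zeroˡ (pow½ i))
  (ℚ.*-monoʳ-≤-nonNeg (pow½ i) {{nonNegative (0≤pow½ i)}} (ι-nonNeg (toℕ (x i))))

sumFrom-cong : ∀ (f h : ℕ → ℚ) a m → (∀ i → i ℕ.≤ m ℕ.+ a → f i ≡ h i) →
               sumFrom f a m ≡ sumFrom h a m
sumFrom-cong f h a zero    f≡h = f≡h a ℕ.≤-refl
sumFrom-cong f h a (suc m) f≡h = cong₂ _+_ (f≡h a (ℕ.m≤n+m a (suc m)))
  (sumFrom-cong f h (suc a) m (λ i i≤ → f≡h i (subst (i ℕ.≤_) (ℕ.+-suc m a) i≤)))

sumFrom-≤-+ : ∀ (f h d : ℕ → ℚ) → (∀ i → f i ≤ h i + d i) →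
              ∀ a m → sumFrom f a m ≤ sumFrom h a m + sumFrom d a m
sumFrom-≤-+ f h d f≤h+d a zero    = f≤h+d a
sumFrom-≤-+ f h d f≤h+d a (suc m) = ℚ.≤-trans
  (ℚ.+-mono-≤ (f≤h+d a) (sumFrom-≤-+ f h d f≤h+d (suc a) m))
  (ℚ.≤-reflexive (solve 4 (λ p q r s → (p :+ q) :+ (r :+ s) := (p :+ r) :+ (q :+ s)) refl
    (h a) (d a) (sumFrom h (suc a) m) (sumFrom d (suc a) m)))

module _ (f : ℕ → ℚ) (f-nonNeg : ∀ i → 0ℚ ≤ f i) where

  sumFrom-tail : a ℕ.≤ b → ∀ m → ∃ λ m′ → sumFrom f b m ≤ sumFrom f a m′
  sumFrom-tail a≤b = tail (ℕ.≤⇒≤′ a≤b)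
    where
    tail : a ≤′ b → ∀ m → ∃ λ m′ → sumFrom f b m ≤ sumFrom f a m′
    tail (≤′-reflexive refl) m = m , ℚ.≤-refl
    tail {b = suc b} (≤′-step a≤′b) m with tail a≤′b (suc m)
    ... | m′ , bound = m′ , ℚ.≤-trans (p≤q+p (f-nonNeg b)) bound

  partial-nonNeg : ∀ n → 0ℚ ≤ partial f n
  partial-nonNeg zero    = ℚ.≤-refl
  partial-nonNeg (suc n) = ℚ.≤-trans (partial-nonNeg n)
    (subst (_≤ partial f n + f n) (ℚ.+-identityʳ _) (ℚ.+-monoʳ-≤ (partial f n) (f-nonNeg n)))

  partial+sumFrom : ∀ a m → partial f a + sumFrom f a m ≡ partial f (suc (m ℕ.+ a))
  partial+sumFrom a zero    = refl
  partial+sumFrom a (suc m) = begin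
    partial f a + (f a + sumFrom f (suc a) m) ≡⟨ ℚ.+-assoc (partial f a) (f a) _ ⟨
    partial f (suc a) + sumFrom f (suc a) m   ≡⟨ partial+sumFrom (suc a) m ⟩
    partial f (suc (m ℕ.+ suc a))             ≡⟨ cong (partial f ∘ suc) (ℕ.+-suc m a) ⟩
    partial f (suc (suc m ℕ.+ a))             ∎
    where open ≡-Reasoning

  sumFrom≤partial : ∀ a m → sumFrom f a m ≤ partial f (suc (m ℕ.+ a))
  sumFrom≤partial a m = subst (sumFrom f a m ≤_) (partial+sumFrom a m) (p≤q+p (partial-nonNeg a))

module _ (x y : ΠM) (ε : ℚ) (x≈y : dist≤ x y ε) where

  private
    gap : ℕ → ℚ
    gap i = ∣ val x i - val y i ∣

    gap-nonNeg : ∀ i → 0ℚ ≤ gap i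
    gap-nonNeg i = ℚ.0≤∣p∣ _

  dist≤⇒coord≤ : ∀ i → ∣ val x i - val y i ∣ ≤ ε
  dist≤⇒coord≤ i = ℚ.≤-trans (p≤q+p (partial-nonNeg gap gap-nonNeg i)) (x≈y (suc i))

  dist≤⇒sumFrom≤ : ∀ a m → sumFrom (val x) a m ≤ sumFrom (val y) a m + ε
  dist≤⇒sumFrom≤ a m = begin
    sumFrom (val x) a m                   ≤⟨ sumFrom-≤-+ (val x) (val y) gap x≤y+gap a m ⟩
    sumFrom (val y) a m + sumFrom gap a m ≤⟨ ℚ.+-monoʳ-≤ (sumFrom (val y) a m) gap-sum≤ε ⟩
    sumFrom (val y) a m + ε               ∎
    where
    open ℚ.≤-Reasoning
    x≤y+gap : ∀ i → val x i ≤ val y i + gap i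
    x≤y+gap i = p≤q+∣p-q∣ (val x i) (val y i)
    gap-sum≤ε : sumFrom gap a m ≤ ε
    gap-sum≤ε = ℚ.≤-trans (sumFrom≤partial gap gap-nonNeg a m) (x≈y (suc (m ℕ.+ a)))

partial-dist-self : ∀ (x : ΠM) n → partial (λ i → ∣ val x i - val x i ∣) n ≡ 0ℚ
partial-dist-self x zero    = refl
partial-dist-self x (suc n) =
  trans (cong₂ _+_ (partial-dist-self x n) (cong ∣_∣ (ℚ.+-inverseʳ (val x n)))) (ℚ.+-identityʳ 0ℚ)

dist≤-refl : ∀ x → 0ℚ ≤ ε → dist≤ x x ε
dist≤-refl {ε} x 0≤ε n = subst (_≤ ε) (sym (partial-dist-self x n)) 0≤ε

-- s →disc a is definitionally Eventually (λ n → s n ≡ a).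
Eventually : (ℕ → Set) → Set
Eventually P = ∃ λ N → ∀ n → N ℕ.≤ n → P n

eventually-∧ : Eventually P → Eventually Q → Eventually (λ n → P n × Q n)
eventually-∧ (N , p) (M , q) = N ℕ.⊔ M , λ n N⊔M≤n →
  p n (ℕ.m⊔n≤o⇒m≤o N M N⊔M≤n) , q n (ℕ.m⊔n≤o⇒n≤o N M N⊔M≤n)

eventually-map : (∀ {n} → P n → Q n) → Eventually P → Eventually Q
eventually-map f (N , p) = N , λ n N≤n → f (p n N≤n)

→𝖬⇒coords-eventually≡ : ∀ (s : ℕ → 𝖬) x → s →𝖬 x →
  ∀ c → Eventually (λ n → ∀ i → i ℕ.≤ c → pt (s n) i ≡ pt x i)
→𝖬⇒coords-eventually≡ s x s→x c = eventually-map coords≡ (s→x (pow½ (suc c)) (0<pow½ (suc c)))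
  where
  coords≡ : ∀ {n} → dist≤ (pt (s n)) (pt x) (pow½ (suc c)) → ∀ i → i ℕ.≤ c → pt (s n) i ≡ pt x i
  coords≡ {n} close i i≤c = val-separated (pt (s n)) (pt x) i
    (ℚ.≤-<-trans (dist≤⇒coord≤ (pt (s n)) (pt x) (pow½ (suc c)) close i)
                 (pow½-antimono-< (s≤s i≤c)))

const→𝖬 : ∀ x → (λ _ → x) →𝖬 x
const→𝖬 x ε 0<ε = 0 , λ _ _ → dist≤-refl (pt x) (ℚ.<⇒≤ 0<ε)

dF-isolated : ∀ q → dF q (pr a b) ≤ pow½ (suc a) → q ≡ pr a b
dF-isolated {a} inf close = ⊥-elim (<⇒≱ (pow½-suc< a) close)
dF-isolated {a} {b} (pr a′ b′) close with a′ ≡ᵇ a in a′≡ᵇa | b′ ≡ᵇ b in b′≡ᵇb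
... | true  | true  = cong₂ pr (ℕ.≡ᵇ⇒≡ a′ a (Equivalence.from T-≡ a′≡ᵇa))
                               (ℕ.≡ᵇ⇒≡ b′ b (Equivalence.from T-≡ b′≡ᵇb))
... | true  | false = ⊥-elim (<⇒≱ (pow½-suc< a) (ℚ.p⊔q≤r⇒q≤r (pow½ a′) (pow½ a) close))
... | false | _     = ⊥-elim (<⇒≱ (pow½-suc< a) (ℚ.p⊔q≤r⇒q≤r (pow½ a′) (pow½ a) close))

Beyond : ℕ → 𝔽 → Set
Beyond N inf      = ⊤
Beyond N (pr a b) = N ℕ.≤ a

dF-near-inf : ∀ q → dF q inf ≤ pow½ N → Beyond N q
dF-near-inf inf      _     = _
dF-near-inf (pr a b) close = pow½-cancel-≤ close

g-pr-cong : ∀ (y w : 𝖬) → sumFrom (val (pt y)) a b ≡ sumFrom (val (pt w)) a b →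
            g y (k , pr a b) ≡ g w (k , pr a b)
g-pr-cong {k = k} y w sums≡ = cong (λ t → if t ≤ᵇ pow½ k then false else true) sums≡

g-beyond≡false : ∀ (y : 𝖬) q → (∀ a b → N ℕ.≤ a → sumFrom (val (pt y)) a b ≤ pow½ k) →
                 Beyond N q → g y (k , q) ≡ false
g-beyond≡false y inf      small _   = refl
g-beyond≡false {k = k} y (pr a b) small N≤a
  with sumFrom (val (pt y)) a b ≤ᵇ pow½ k | ℚ.≤⇒≤ᵇ (small a b N≤a)
... | true | _ = refl

tail-sums≤ : ∀ (y x : ΠM) → dist≤ y x ε → (∀ m → sumFrom (val x) N m ≤ δ) →
  ∀ a b → N ℕ.≤ a → sumFrom (val y) a b ≤ δ + ε
tail-sums≤ {ε = ε} y x y≈x x-tail a b N≤a with sumFrom-tail (val x) (val-nonNeg x) N≤a b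
... | m′ , a-block≤N-block = ℚ.≤-trans (dist≤⇒sumFrom≤ y x ε y≈x a b)
  (ℚ.+-monoˡ-≤ ε (ℚ.≤-trans a-block≤N-block (x-tail m′)))

module _ (s : ℕ → 𝖬) (x : 𝖬) (s→x : s →𝖬 x) (z : ℕ → ℕ × 𝔽) where

  g→Exp-at-pr : z →ℕ𝔽 (k , pr a b) → (λ n → g (s n) (z n)) →disc g x (k , pr a b)
  g→Exp-at-pr {k} {a} {b} (k-eventually , z→pr) =
    eventually-map step (eventually-∧ k-eventually (eventually-∧ pr-eventually coords-eventually))
    where
    pr-eventually : Eventually (λ n → proj₂ (z n) ≡ pr a b)
    pr-eventually = eventually-map (dF-isolated _) (z→pr (pow½ (suc a)) (0<pow½ (suc a)))
    coords-eventually : Eventually (λ n → ∀ i → i ℕ.≤ b ℕ.+ a → pt (s n) i ≡ pt x i)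
    coords-eventually = →𝖬⇒coords-eventually≡ s x s→x (b ℕ.+ a)
    step : ∀ {n} → proj₁ (z n) ≡ k × proj₂ (z n) ≡ pr a b ×
                   (∀ i → i ℕ.≤ b ℕ.+ a → pt (s n) i ≡ pt x i) →
           g (s n) (z n) ≡ g x (k , pr a b)
    step {n} (k≡ , pr≡ , coords≡) = trans (cong (g (s n)) (cong₂ _,_ k≡ pr≡))
      (g-pr-cong {a} {b} {k} (s n) x (sumFrom-cong (val (pt (s n))) (val (pt x)) a b
        (λ i i≤b+a → cong (λ j → ι (toℕ j) * pow½ i) (coords≡ i i≤b+a))))

  g→Exp-at-inf : z →ℕ𝔽 (k , inf) → (λ n → g (s n) (z n)) →disc false
  g→Exp-at-inf {k} (k-eventually , z→inf) with summ x (pow½ (suc k)) (0<pow½ (suc k))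
  ... | N , x-tail = eventually-map step (eventually-∧ k-eventually (eventually-∧ s-close z-beyond))
    where
    s-close : Eventually (λ n → dist≤ (pt (s n)) (pt x) (pow½ (suc k)))
    s-close = s→x (pow½ (suc k)) (0<pow½ (suc k))
    z-beyond : Eventually (λ n → Beyond N (proj₂ (z n)))
    z-beyond = eventually-map (dF-near-inf _) (z→inf (pow½ N) (0<pow½ N))
    step : ∀ {n} → proj₁ (z n) ≡ k × dist≤ (pt (s n)) (pt x) (pow½ (suc k)) ×
                   Beyond N (proj₂ (z n)) →
           g (s n) (z n) ≡ false
    step {n} (k≡ , s≈x , beyond) = trans (cong (λ k′ → g (s n) (k′ , proj₂ (z n))) k≡)
      (g-beyond≡false {N = N} {k = k} (s n) (proj₂ (z n)) small beyond)
      where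
      small : ∀ a b → N ℕ.≤ a → sumFrom (val (pt (s n))) a b ≤ pow½ k
      small a b N≤a = subst (_ ≤_) (pow½-suc+pow½-suc k)
        (tail-sums≤ (pt (s n)) (pt x) s≈x x-tail a b N≤a)

→𝖬⇒g→Exp : ∀ (s : ℕ → 𝖬) x → s →𝖬 x → (λ n → g (s n)) →Exp g x
→𝖬⇒g→Exp s x s→x z (k , pr a b) = g→Exp-at-pr s x s→x z
→𝖬⇒g→Exp s x s→x z (k , inf)    = g→Exp-at-inf s x s→x z

lemma3p3 :
    (∀ (x y : 𝖬) → (∀ i → proj₁ (e x) i ≡ proj₁ (e y) i)
                  → (∀ z → proj₂ (e x) z ≡ proj₂ (e y) z)
                  → ∀ i → pt x i ≡ pt y i)
    × (∀ (x : 𝖬) → Cont (proj₂ (e x)))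
    × (∀ (s : ℕ → 𝖬) (x : 𝖬) → s →𝖬 x
         → ((λ n → proj₁ (e (s n))) →𝕄 proj₁ (e x))
           × ((λ n → proj₂ (e (s n))) →Exp proj₂ (e x)))
lemma3p3 =
  (λ x y pt≡ _ → pt≡) ,
  (λ x → →𝖬⇒g→Exp (λ _ → x) x (const→𝖬 x)) ,
  λ s x s→x →
    (λ i → eventually-map (λ coords≡ → coords≡ i ℕ.≤-refl) (→𝖬⇒coords-eventually≡ s x s→x i)) ,
    →𝖬⇒g→Exp s x s→x
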